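{- For all integers $C\ge1$ and $\Delta\ge1$, $$M(C,\Delta)\ge \left\lceil \frac{C+1}{C}\cdot\frac{\Delta}{2}\right\rceil.$$
   Context: Consider a ring with node set $V(C_n)$ of $n$ nodes. A request graph is a simple graph $R$ whose vertices are nodes of the ring. Given integers $n,C,\Delta\ge1$, an assignment of nonnegative integers $A(v)$, $v\in V(C_n)$, is feasible if for every request graph $R$ of maximum degree at most $\Delta$ there exists a partition of $E(R)$ into subgraphs $B_1,\dots,B_\Lambda$ such that $|E(B_\lambda)|\le C$ for all $\lambda$ and every vertex $v$ appears in at most $A(v)$ of the subgraphs $B_\lambda$. $A(n,C,\Delta)$ denotes the minimum of $\sum_{v}A(v)$ over all feasible assignments. $M(C,\Delta)$ is the least positive number $M$ such that $A(n,C,\Delta)\le Mn$ for every $n\ge1$. -}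

module Defs where

open import Data.Nat using (ℕ; zero; suc; _+_; _*_; _∸_; _≤_; _<ᵇ_)
open import Data.Nat.DivMod using (_/_)
open import Data.Bool using (Bool; true; false; if_then_else_; _∧_; _∨_)
open import Data.Fin using (Fin; toℕ) renaming (zero to fz; suc to fs)
import Data.Fin as Fin
open import Data.Product using (Σ; ∃; _×_)
open import Relation.Nullary.Decidable using (⌊_⌋)
open import Relation.Binary.PropositionalEquality using (_≡_)

sumF : ∀ {n} → (Fin n → ℕ) → ℕ
sumF {zero}  f = 0
sumF {suc n} f = f fz + sumF (λ i → f (fs i))

countF : ∀ {n} → (Fin n → Bool) → ℕ
countF P = sumF (λ i → if P i then 1 else 0)

anyF : ∀ {n} → (Fin n → Bool) → Bool
anyF {zero}  P = false
anyF {suc n} P = P fz ∨ anyF (λ i → P (fs i))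

-- ceiling of a / b (b ≥ 1); value 0 for b = 0 is irrelevant
ceilDiv : ℕ → ℕ → ℕ
ceilDiv a zero    = 0
ceilDiv a (suc b) = (a + b) / suc b

-- A (request) simple graph whose vertices are the n ring nodes Fin n,
-- given by a symmetric irreflexive adjacency predicate.
record Graph (n : ℕ) : Set where
  field
    adj    : Fin n → Fin n → Bool
    sym    : ∀ i j → adj i j ≡ adj j i
    irrefl : ∀ i → adj i i ≡ false
open Graph public

degree : ∀ {n} → Graph n → Fin n → ℕ
degree R v = countF (adj R v)

MaxDegreeAtMost : ∀ {n} → Graph n → ℕ → Set
MaxDegreeAtMost R Δ = ∀ v → degree R v ≤ Δ

-- A partition of E(R) into subgraphs B_1..B_Λ is given by a colouring
-- c of the edges by Fin Λ (c is symmetric; its values on non-edges are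
-- irrelevant). B_λ = edges of colour λ.

classSize : ∀ {n Λ} → Graph n → (Fin n → Fin n → Fin Λ) → Fin Λ → ℕ
classSize R c l =
  sumF (λ i → countF (λ j → (toℕ i <ᵇ toℕ j) ∧ (adj R i j ∧ ⌊ c i j Fin.≟ l ⌋)))

appearsIn : ∀ {n Λ} → Graph n → (Fin n → Fin n → Fin Λ) → Fin n → Fin Λ → Bool
appearsIn R c v l = anyF (λ u → adj R v u ∧ ⌊ c v u Fin.≟ l ⌋)

appearances : ∀ {n Λ} → Graph n → (Fin n → Fin n → Fin Λ) → Fin n → ℕ
appearances R c v = countF (appearsIn R c v)

Feasible : (n C Δ : ℕ) → (Fin n → ℕ) → Set
Feasible n C Δ A =
  (R : Graph n) → MaxDegreeAtMost R Δ →
  Σ ℕ λ Λ → Σ (Fin n → Fin n → Fin Λ) λ c →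
    (∀ i j → c i j ≡ c j i) ×
    (∀ l → classSize R c l ≤ C) ×
    (∀ v → appearances R c v ≤ A v)

-- M = m/d (d ≥ 1) satisfies A(n,C,Δ) ≤ M n for all n ≥ 1,
-- i.e. d·A(n,C,Δ) ≤ m·n
BoundHolds : (C Δ m d : ℕ) → Set
BoundHolds C Δ m d =
  ∀ n → 1 ≤ n → Σ (Fin n → ℕ) λ A → Feasible n C Δ A × (d * sumF A ≤ m * n)

module Submission where

-- Let K = ⌈(C+1)Δ/2C⌉ and fix a feasible assignment A. On the set S of nodes with
-- A v < K build greedily a request graph R of maximum degree at most Δ in which
-- every nonempty subgraph with at most C edges has more vertices than edges: scan
-- all pairs and join two nodes of S of degree < Δ whenever they are at distance
-- > 2C (such an edge closes no short cycle). Afterwards all nodes of S of degree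
-- < Δ lie in one ball of radius 2C, so there are at most (Δ+1)^{2C} of them and R
-- has at least Δ(|S| - (Δ+1)^{2C})/2 edges. In a partition of E(R) into parts of
-- at most C edges a part with e edges meets at least e + 1 ≥ (C+1)e/C nodes, so
-- nodes appear in at least (C+1)|E(R)|/C parts in total, while a node of S appears
-- in at most K - 1 parts and any other node in none. By the choice of K this
-- bounds |S| by (C+1)Δ(Δ+1)^{2C}, independently of n, so the total budget is at
-- least K(n - (C+1)Δ(Δ+1)^{2C}), and letting n grow gives M(C,Δ) ≥ K.

open import Defs hiding (sym)
open import Data.Bool using (Bool; true; false; if_then_else_; _∧_; _∨_; not; T)
open import Data.Bool.Properties
  using (∧-comm; ∨-comm; ∧-zeroʳ; ∧-identityʳ; ∨-zeroʳ; ∨-identityʳ; ∧-conicalˡ; ∧-conicalʳ; ∨-conicalˡ; ∨-conicalʳ;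
         not-injective)
open import Data.Fin using (Fin; toℕ) renaming (zero to fz; suc to fs)
import Data.Fin as Fin
open import Data.Fin.Properties using (toℕ-injective; toℕ<n)
open import Data.Nat using (ℕ; zero; suc; _+_; _*_; _∸_; _^_; _≤_; _<_; _<ᵇ_; z≤n; s≤s; _≤?_)
open import Data.Nat.Properties
open import Data.Nat.DivMod using (m/n*n≤m)
open import Data.Nat.Tactic.RingSolver using (solve-∀)
open import Algebra.Properties.CommutativeSemigroup +-commutativeSemigroup using (interchange)
open import Data.List using (List; []; _∷_; foldl; cartesianProduct; allFin)
open import Data.List.Membership.Propositional using (_∈_)
open import Data.List.Membership.Propositional.Properties using (∈-cartesianProduct⁺; ∈-allFin)
open import Data.List.Relation.Unary.Any using (here; there)
open import Data.Product using (∃; _×_; _,_; proj₁; proj₂)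
open import Data.Sum using (_⊎_; inj₁; inj₂)
open import Data.Unit using (tt)
open import Function using (_∘_; id)
open import Relation.Binary.Definitions using (tri<; tri≈; tri>)
open import Relation.Binary.PropositionalEquality
open import Relation.Nullary using (yes; no; contradiction)
open import Relation.Nullary.Decidable using (⌊_⌋; isYes≗does; dec-true; toWitness)

𝟙 : Bool → ℕ
𝟙 b = if b then 1 else 0

sumF-cong : ∀ {n} {f g : Fin n → ℕ} → (∀ i → f i ≡ g i) → sumF f ≡ sumF g
sumF-cong {zero}  f≗g = refl
sumF-cong {suc n} f≗g = cong₂ _+_ (f≗g fz) (sumF-cong (f≗g ∘ fs))

sumF-mono-≤ : ∀ {n} {f g : Fin n → ℕ} → (∀ i → f i ≤ g i) → sumF f ≤ sumF g
sumF-mono-≤ {zero}  f≤g = z≤n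
sumF-mono-≤ {suc n} f≤g = +-mono-≤ (f≤g fz) (sumF-mono-≤ (f≤g ∘ fs))

sumF-+ : ∀ {n} (f g : Fin n → ℕ) → sumF (λ i → f i + g i) ≡ sumF f + sumF g
sumF-+ {zero}  f g = refl
sumF-+ {suc n} f g = trans (cong (f fz + g fz +_) (sumF-+ (f ∘ fs) (g ∘ fs)))
                           (interchange (f fz) (g fz) (sumF (f ∘ fs)) (sumF (g ∘ fs)))

sumF-*ˡ : ∀ {n} k (f : Fin n → ℕ) → sumF (λ i → k * f i) ≡ k * sumF f
sumF-*ˡ {zero}  k f = sym (*-zeroʳ k)
sumF-*ˡ {suc n} k f = trans (cong (k * f fz +_) (sumF-*ˡ k (f ∘ fs))) (sym (*-distribˡ-+ k (f fz) _))

sumF-const : ∀ {n} k → sumF {n} (λ _ → k) ≡ n * k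
sumF-const {zero}  k = refl
sumF-const {suc n} k = cong (k +_) (sumF-const {n} k)

sumF-zero : ∀ {n} {f : Fin n → ℕ} → (∀ i → f i ≡ 0) → sumF f ≡ 0
sumF-zero {zero}  f≗0 = refl
sumF-zero {suc n} f≗0 = cong₂ _+_ (f≗0 fz) (sumF-zero (f≗0 ∘ fs))

sumF≡0⇒≡0 : ∀ {n} (f : Fin n → ℕ) → sumF f ≡ 0 → ∀ i → f i ≡ 0
sumF≡0⇒≡0 f e fz     = m+n≡0⇒m≡0 (f fz) e
sumF≡0⇒≡0 f e (fs i) = sumF≡0⇒≡0 (f ∘ fs) (m+n≡0⇒n≡0 (f fz) e) i

f≤sumF : ∀ {n} (f : Fin n → ℕ) i → f i ≤ sumF f
f≤sumF f fz     = m≤m+n (f fz) _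
f≤sumF f (fs i) = ≤-trans (f≤sumF (f ∘ fs) i) (m≤n+m _ (f fz))

sumF-swap : ∀ {m n} (f : Fin m → Fin n → ℕ) →
  sumF (λ i → sumF (λ j → f i j)) ≡ sumF (λ j → sumF (λ i → f i j))
sumF-swap {zero} {n} f = sym (sumF-zero {n} (λ _ → refl))
sumF-swap {suc m} f = trans (cong (sumF (f fz) +_) (sumF-swap (f ∘ fs)))
                            (sym (sumF-+ (f fz) (λ j → sumF (λ i → f (fs i) j))))

sumF<n⇒∃≡0 : ∀ {n} (f : Fin n → ℕ) → sumF f < n → ∃ λ i → f i ≡ 0
sumF<n⇒∃≡0 {suc n} f lt with f fz in f₀
... | zero  = fz , f₀
... | suc a with sumF<n⇒∃≡0 (f ∘ fs) (≤-trans (s≤s (m≤n+m _ a)) (≤-pred lt))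
...   | i , fi≡0 = fs i , fi≡0

∨-introˡ : ∀ {a} b → a ≡ true → a ∨ b ≡ true
∨-introˡ b a≡true = cong (_∨ b) a≡true

∨-introʳ : ∀ a {b} → b ≡ true → a ∨ b ≡ true
∨-introʳ a b≡true = trans (cong (a ∨_) b≡true) (∨-zeroʳ a)

∧-intro : ∀ {a b} → a ≡ true → b ≡ true → a ∧ b ≡ true
∧-intro = cong₂ _∧_

not≡true⇒≡false : ∀ {b} → not b ≡ true → b ≡ false
not≡true⇒≡false = not-injective {y = false}

≟-refl : ∀ {n} (u : Fin n) → ⌊ u Fin.≟ u ⌋ ≡ true
≟-refl u = trans (isYes≗does (u Fin.≟ u)) (dec-true (u Fin.≟ u) refl)

≟≡true⇒≡ : ∀ {n} {u v : Fin n} → ⌊ u Fin.≟ v ⌋ ≡ true → u ≡ v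
≟≡true⇒≡ e = toWitness (subst T (sym e) tt)

<⇒<ᵇ≡true : ∀ {m n} → m < n → (m <ᵇ n) ≡ true
<⇒<ᵇ≡true {m} {n} m<n with m <ᵇ n | <⇒<ᵇ m<n
... | true | _ = refl

<ᵇ≡true⇒< : ∀ {m n} → (m <ᵇ n) ≡ true → m < n
<ᵇ≡true⇒< {m} {n} e = <ᵇ⇒< m n (subst T (sym e) tt)

<ᵇ≡false⇒≥ : ∀ {m n} → (m <ᵇ n) ≡ false → n ≤ m
<ᵇ≡false⇒≥ e = ≮⇒≥ (λ m<n → subst T e (<⇒<ᵇ m<n))

≥⇒<ᵇ≡false : ∀ {m n} → n ≤ m → (m <ᵇ n) ≡ false
≥⇒<ᵇ≡false {m} {n} n≤m with m <ᵇ n in e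
... | false = refl
... | true  = contradiction n≤m (<⇒≱ (<ᵇ≡true⇒< e))

𝟙-mono : ∀ {a b} → (a ≡ true → b ≡ true) → 𝟙 a ≤ 𝟙 b
𝟙-mono {false} a⇒b = z≤n
𝟙-mono {true}  a⇒b rewrite a⇒b refl = ≤-refl

countF-mono : ∀ {n} {P Q : Fin n → Bool} → (∀ i → P i ≡ true → Q i ≡ true) → countF P ≤ countF Q
countF-mono P⇒Q = sumF-mono-≤ (λ i → 𝟙-mono (P⇒Q i))

countF-∨ : ∀ {n} (P Q : Fin n → Bool) → countF (λ i → P i ∨ Q i) ≤ countF P + countF Q
countF-∨ P Q = ≤-trans (sumF-mono-≤ (λ i → 𝟙-∨ (P i) (Q i))) (≤-reflexive (sumF-+ (𝟙 ∘ P) (𝟙 ∘ Q)))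
  where
  𝟙-∨ : ∀ a b → 𝟙 (a ∨ b) ≤ 𝟙 a + 𝟙 b
  𝟙-∨ false b = ≤-refl
  𝟙-∨ true  b = s≤s z≤n

countF-split : ∀ {n} (X P : Fin n → Bool) →
  countF P ≡ countF (λ i → X i ∧ P i) + countF (λ i → not (X i) ∧ P i)
countF-split X P = trans (sumF-cong (λ i → 𝟙-split (X i) (P i)))
                         (sumF-+ (λ i → 𝟙 (X i ∧ P i)) (λ i → 𝟙 (not (X i) ∧ P i)))
  where
  𝟙-split : ∀ x p → 𝟙 p ≡ 𝟙 (x ∧ p) + 𝟙 (not x ∧ p)
  𝟙-split true  p = sym (+-identityʳ _)
  𝟙-split false p = refl

countF-false : ∀ {n} {P : Fin n → Bool} → (∀ i → P i ≡ false) → countF P ≡ 0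
countF-false P≗false = sumF-zero (λ i → cong 𝟙 (P≗false i))

countF≡0⇒false : ∀ {n} (P : Fin n → Bool) → countF P ≡ 0 → ∀ i → P i ≡ false
countF≡0⇒false P e i = 𝟙≡0 (P i) (sumF≡0⇒≡0 (𝟙 ∘ P) e i)
  where
  𝟙≡0 : ∀ b → 𝟙 b ≡ 0 → b ≡ false
  𝟙≡0 false _ = refl

countF-pos : ∀ {n} (P : Fin n → Bool) i → P i ≡ true → 1 ≤ countF P
countF-pos P i Pi = ≤-trans (≤-reflexive (cong 𝟙 (sym Pi))) (f≤sumF (𝟙 ∘ P) i)

countF-≟ : ∀ {k} (x : Fin k) → countF (λ l → ⌊ x Fin.≟ l ⌋) ≡ 1
countF-≟ {suc k} fz = cong suc (countF-false {k} (λ _ → refl))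
countF-≟ (fs x) = trans (sumF-cong (λ l → cong 𝟙 (≟-suc l))) (countF-≟ x)
  where
  ≟-suc : ∀ l → ⌊ fs x Fin.≟ fs l ⌋ ≡ ⌊ x Fin.≟ l ⌋
  ≟-suc l = trans (isYes≗does (fs x Fin.≟ fs l)) (sym (isYes≗does (x Fin.≟ l)))

countF-∧-≟ : ∀ {k} (b : Bool) (x : Fin k) → countF (λ l → b ∧ ⌊ x Fin.≟ l ⌋) ≡ 𝟙 b
countF-∧-≟ {k} false x = countF-false {k} (λ _ → refl)
countF-∧-≟ true  x = countF-≟ x

anyF-sound : ∀ {n} (P : Fin n → Bool) → anyF P ≡ true → ∃ λ i → P i ≡ true
anyF-sound {suc n} P e with P fz in P₀
... | true  = fz , P₀
... | false with anyF-sound (P ∘ fs) e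
...   | i , Pi = fs i , Pi

anyF-intro : ∀ {n} (P : Fin n → Bool) i → P i ≡ true → anyF P ≡ true
anyF-intro P fz     Pi = ∨-introˡ _ Pi
anyF-intro P (fs i) Pi = ∨-introʳ (P fz) (anyF-intro (P ∘ fs) i Pi)

anyF-false : ∀ {n} {P : Fin n → Bool} → (∀ i → P i ≡ false) → anyF P ≡ false
anyF-false {zero}  P≗false = refl
anyF-false {suc n} P≗false rewrite P≗false fz = anyF-false (P≗false ∘ fs)

anyF≡false⇒ : ∀ {n} (P : Fin n → Bool) → anyF P ≡ false → ∀ i → P i ≡ false
anyF≡false⇒ P e fz     = ∨-conicalˡ _ _ e
anyF≡false⇒ P e (fs i) = anyF≡false⇒ (P ∘ fs) (∨-conicalʳ _ _ e) i

countF-anyF : ∀ {n k} (Q : Fin k → Fin n → Bool) →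
  countF (λ v → anyF (λ x → Q x v)) ≤ sumF (λ x → countF (Q x))
countF-anyF {n} {zero}  Q = ≤-reflexive (countF-false {n} (λ _ → refl))
countF-anyF {n} {suc k} Q = ≤-trans (countF-∨ (Q fz) (λ v → anyF (λ x → Q (fs x) v)))
                                    (+-monoʳ-≤ (countF (Q fz)) (countF-anyF (Q ∘ fs)))

Adj : ℕ → Set
Adj n = Fin n → Fin n → Bool

module _ {n : ℕ} where

  Symmetric : Adj n → Set
  Symmetric E = ∀ a b → E a b ≡ E b a

  Irreflexive : Adj n → Set
  Irreflexive E = ∀ a → E a a ≡ false

  infix 4 _⊆_
  _⊆_ : Adj n → Adj n → Set
  E ⊆ F = ∀ a b → E a b ≡ true → F a b ≡ true

  degreeSum : Adj n → ℕ
  degreeSum E = sumF (λ a → countF (E a))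

  support : Adj n → ℕ
  support E = countF (λ v → anyF (E v))

  edgeCount : Adj n → ℕ
  edgeCount E = sumF (λ i → countF (λ j → (toℕ i <ᵇ toℕ j) ∧ E i j))

  ⊆-trans : ∀ {E F G : Adj n} → E ⊆ F → F ⊆ G → E ⊆ G
  ⊆-trans E⊆F F⊆G a b = F⊆G a b ∘ E⊆F a b

  degreeSum-mono : ∀ {E F : Adj n} → E ⊆ F → degreeSum E ≤ degreeSum F
  degreeSum-mono E⊆F = sumF-mono-≤ (λ a → countF-mono (E⊆F a))

  handshake : ∀ {E : Adj n} → Symmetric E → Irreflexive E → degreeSum E ≡ 2 * edgeCount E
  handshake {E} E-sym E-irr = begin
      degreeSum E
    ≡⟨ sumF-cong (λ i → trans (sumF-cong (split i)) (sumF-+ (up i) (down i))) ⟩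
      sumF (λ i → sumF (up i) + sumF (down i))
    ≡⟨ sumF-+ (sumF ∘ up) (sumF ∘ down) ⟩
      edgeCount E + sumF (sumF ∘ down)
    ≡⟨ cong (edgeCount E +_) down≡up ⟩
      edgeCount E + edgeCount E
    ≡⟨ cong (edgeCount E +_) (sym (+-identityʳ _)) ⟩
      2 * edgeCount E
    ∎
    where
    open ≡-Reasoning
    up down : Fin n → Fin n → ℕ
    up   i j = 𝟙 ((toℕ i <ᵇ toℕ j) ∧ E i j)
    down i j = 𝟙 ((toℕ j <ᵇ toℕ i) ∧ E i j)
    down≡up : sumF (sumF ∘ down) ≡ edgeCount E
    down≡up = trans (sumF-cong (λ i → sumF-cong (λ j → cong (λ b → 𝟙 ((toℕ j <ᵇ toℕ i) ∧ b)) (E-sym i j))))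
                    (sumF-swap (λ i j → up j i))
    split : ∀ i j → 𝟙 (E i j) ≡ up i j + down i j
    split i j with <-cmp (toℕ i) (toℕ j)
    ... | tri< i<j _ _ rewrite <⇒<ᵇ≡true i<j | ≥⇒<ᵇ≡false (<⇒≤ i<j) = sym (+-identityʳ _)
    ... | tri> _ _ j<i rewrite <⇒<ᵇ≡true j<i | ≥⇒<ᵇ≡false (<⇒≤ j<i) = refl
    ... | tri≈ _ i≡j _ rewrite toℕ-injective i≡j | E-irr j | ≥⇒<ᵇ≡false (≤-refl {toℕ j}) = refl

colourClass : ∀ {n Λ} → Adj n → (Fin n → Fin n → Fin Λ) → Fin Λ → Adj n
colourClass M c l a b = M a b ∧ ⌊ c a b Fin.≟ l ⌋

module _ {n Λ : ℕ} (M : Adj n) (c : Fin n → Fin n → Fin Λ) where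

  colourClass-⊆ : ∀ l → colourClass M c l ⊆ M
  colourClass-⊆ l a b = ∧-conicalˡ _ _

  colourClass-sym : Symmetric M → (∀ a b → c a b ≡ c b a) → ∀ l → Symmetric (colourClass M c l)
  colourClass-sym M-sym c-sym l a b = cong₂ (λ x y → x ∧ ⌊ y Fin.≟ l ⌋) (M-sym a b) (c-sym a b)

  colourClass-irrefl : Irreflexive M → ∀ l → Irreflexive (colourClass M c l)
  colourClass-irrefl M-irr l a rewrite M-irr a = refl

degreeSum-colourClasses : ∀ {n Λ} (M : Adj n) (c : Fin n → Fin n → Fin Λ) →
  sumF (λ l → degreeSum (colourClass M c l)) ≡ degreeSum M
degreeSum-colourClasses M c = begin
    sumF (λ l → sumF (λ a → sumF (λ b → 𝟙 (colourClass M c l a b))))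
  ≡⟨ sym (sumF-swap (λ a l → sumF (λ b → 𝟙 (colourClass M c l a b)))) ⟩
    sumF (λ a → sumF (λ l → sumF (λ b → 𝟙 (colourClass M c l a b))))
  ≡⟨ sumF-cong (λ a → sym (sumF-swap (λ b l → 𝟙 (colourClass M c l a b)))) ⟩
    sumF (λ a → sumF (λ b → countF (λ l → colourClass M c l a b)))
  ≡⟨ sumF-cong (λ a → sumF-cong (λ b → countF-∧-≟ (M a b) (c a b))) ⟩
    degreeSum M
  ∎
  where open ≡-Reasoning

-- Balls

ball : ∀ {n} → Adj n → ℕ → Fin n → Fin n → Bool
ball M zero    u v = ⌊ u Fin.≟ v ⌋
ball M (suc k) u v = ball M k u v ∨ anyF (λ x → ball M k u x ∧ M x v)

module _ {n : ℕ} (M : Adj n) where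

  ball-suc : ∀ k u v → ball M k u v ≡ true → ball M (suc k) u v ≡ true
  ball-suc k u v = ∨-introˡ _

  ball-centre : ∀ k u → ball M k u u ≡ true
  ball-centre zero    u = ≟-refl u
  ball-centre (suc k) u = ball-suc k u u (ball-centre k u)

  ball-step : ∀ k u a b → ball M k u a ≡ true → M a b ≡ true → ball M (suc k) u b ≡ true
  ball-step k u a b ua Mab =
    ∨-introʳ (ball M k u b) (anyF-intro (λ x → ball M k u x ∧ M x b) a (∧-intro ua Mab))

  ball-mono-≤ : ∀ {k k′} u v → k ≤ k′ → ball M k u v ≡ true → ball M k′ u v ≡ true
  ball-mono-≤ {k} {k′} u v k≤k′ uv = subst (λ r → ball M r u v ≡ true) (m∸n+n≡m k≤k′) (grow (k′ ∸ k))
    where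
    grow : ∀ d → ball M (d + k) u v ≡ true
    grow zero    = uv
    grow (suc d) = ball-suc (d + k) u v (grow d)

  far⇒≢ : ∀ {k u w} → ball M k u w ≡ false → u ≢ w
  far⇒≢ {k} {u} far refl with trans (sym far) (ball-centre k u)
  ... | ()

  ball-size : ∀ Δ → (∀ x → countF (M x) ≤ Δ) → ∀ k u → countF (ball M k u) ≤ suc Δ ^ k
  ball-size Δ deg≤Δ zero    u = ≤-reflexive (countF-≟ u)
  ball-size Δ deg≤Δ (suc k) u = begin
      countF (ball M (suc k) u)
    ≤⟨ countF-∨ (ball M k u) (λ v → anyF (λ x → ball M k u x ∧ M x v)) ⟩
      B + countF (λ v → anyF (λ x → ball M k u x ∧ M x v))
    ≤⟨ +-monoʳ-≤ B (countF-anyF (λ x v → ball M k u x ∧ M x v)) ⟩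
      B + sumF (λ x → countF (λ v → ball M k u x ∧ M x v))
    ≤⟨ +-monoʳ-≤ B (sumF-mono-≤ (λ x → neighbours x (ball M k u x))) ⟩
      B + sumF (λ x → Δ * 𝟙 (ball M k u x))
    ≡⟨ cong (B +_) (sumF-*ˡ Δ (λ x → 𝟙 (ball M k u x))) ⟩
      B + Δ * B
    ≤⟨ *-monoʳ-≤ (suc Δ) (ball-size Δ deg≤Δ k u) ⟩
      suc Δ ^ suc k
    ∎
    where
    open ≤-Reasoning
    B = countF (ball M k u)
    neighbours : ∀ x b → countF (λ v → b ∧ M x v) ≤ Δ * 𝟙 b
    neighbours x false = ≤-reflexive (trans (countF-false {n} (λ _ → refl)) (sym (*-zeroʳ Δ)))
    neighbours x true  = ≤-trans (deg≤Δ x) (≤-reflexive (sym (*-identityʳ Δ)))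

ball-mono-⊆ : ∀ {n} {M M′ : Adj n} → M ⊆ M′ → ∀ k u v → ball M k u v ≡ true → ball M′ k u v ≡ true
ball-mono-⊆ M⊆M′ zero u v uv = uv
ball-mono-⊆ {M = M} {M′} M⊆M′ (suc k) u v uv with ball M k u v in near
... | true  = ball-suc M′ k u v (ball-mono-⊆ M⊆M′ k u v near)
... | false with anyF-sound (λ x → ball M k u x ∧ M x v) uv
...   | x , ux∧Mxv = ball-step M′ k u x v (ball-mono-⊆ M⊆M′ k u x (∧-conicalˡ _ _ ux∧Mxv))
                                         (M⊆M′ x v (∧-conicalʳ _ _ ux∧Mxv))

module _ {n : ℕ} where

  arc : Fin n → Fin n → Adj n
  arc u w a b = ⌊ u Fin.≟ a ⌋ ∧ ⌊ w Fin.≟ b ⌋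

  edge : Fin n → Fin n → Adj n
  edge u w a b = arc u w a b ∨ arc w u a b

  addEdge : Adj n → Fin n → Fin n → Adj n
  addEdge M u w a b = M a b ∨ edge u w a b

  removeEdge : Adj n → Fin n → Fin n → Adj n
  removeEdge E u w a b = E a b ∧ not (edge u w a b)

  arc≡true⇒ : ∀ u w a b → arc u w a b ≡ true → u ≡ a × w ≡ b
  arc≡true⇒ u w a b e = ≟≡true⇒≡ (∧-conicalˡ _ _ e) , ≟≡true⇒≡ (∧-conicalʳ _ _ e)

  edge≡true⇒ : ∀ u w a b → edge u w a b ≡ true → (u ≡ a × w ≡ b) ⊎ (w ≡ a × u ≡ b)
  edge≡true⇒ u w a b e with arc u w a b in uw
  ... | true  = inj₁ (arc≡true⇒ u w a b uw)
  ... | false = inj₂ (arc≡true⇒ w u a b e)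

  edge-flip : ∀ u w a b → edge u w b a ≡ edge u w a b
  edge-flip u w a b =
    trans (cong₂ _∨_ (∧-comm ⌊ u Fin.≟ b ⌋ _) (∧-comm ⌊ w Fin.≟ b ⌋ _)) (∨-comm (arc w u a b) _)

  edge-irrefl : ∀ {u w} → u ≢ w → ∀ a → edge u w a a ≡ false
  edge-irrefl {u} {w} u≢w a with edge u w a a in e
  ... | false = refl
  ... | true with edge≡true⇒ u w a a e
  ...   | inj₁ (refl , refl) = contradiction refl u≢w
  ...   | inj₂ (refl , refl) = contradiction refl u≢w

  countF-arc : ∀ u w v → countF (arc u w v) ≡ 𝟙 ⌊ u Fin.≟ v ⌋
  countF-arc u w v = countF-∧-≟ ⌊ u Fin.≟ v ⌋ w

  degreeSum-arc : ∀ u w → degreeSum (arc u w) ≡ 1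
  degreeSum-arc u w = trans (sumF-cong (countF-arc u w)) (countF-≟ u)

  addEdge-sym : ∀ {M u w} → Symmetric M → Symmetric (addEdge M u w)
  addEdge-sym {u = u} {w} M-sym a b = cong₂ _∨_ (M-sym a b) (sym (edge-flip u w a b))

  addEdge-irrefl : ∀ {M u w} → Irreflexive M → u ≢ w → Irreflexive (addEdge M u w)
  addEdge-irrefl M-irr u≢w a = cong₂ _∨_ (M-irr a) (edge-irrefl u≢w a)

  addEdge-new : ∀ M u w → addEdge M u w u w ≡ true
  addEdge-new M u w = ∨-introʳ (M u w) (∨-introˡ _ (∧-intro (≟-refl u) (≟-refl w)))

  ⊆-addEdge : ∀ {M} u w → M ⊆ addEdge M u w
  ⊆-addEdge u w a b = ∨-introˡ _

  addEdge-sources : ∀ {M u w} (P : Fin n → Bool) → (∀ a b → M a b ≡ true → P a ≡ true) →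
    P u ≡ true → P w ≡ true → ∀ a b → addEdge M u w a b ≡ true → P a ≡ true
  addEdge-sources {M} {u} {w} P M⇒P Pu Pw a b e with M a b in Mab
  ... | true = M⇒P a b Mab
  ... | false with edge≡true⇒ u w a b e
  ...   | inj₁ (refl , _) = Pu
  ...   | inj₂ (refl , _) = Pw

  addEdge-degree : ∀ M u w v →
    countF (addEdge M u w v) ≤ countF (M v) + 𝟙 ⌊ u Fin.≟ v ⌋ + 𝟙 ⌊ w Fin.≟ v ⌋
  addEdge-degree M u w v = begin
      countF (addEdge M u w v)
    ≤⟨ countF-∨ (M v) (edge u w v) ⟩
      countF (M v) + countF (edge u w v)
    ≤⟨ +-monoʳ-≤ (countF (M v)) (countF-∨ (arc u w v) (arc w u v)) ⟩
      countF (M v) + (countF (arc u w v) + countF (arc w u v))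
    ≡⟨ trans (sym (+-assoc (countF (M v)) _ _))
             (cong₂ (λ x y → countF (M v) + x + y) (countF-arc u w v) (countF-arc w u v)) ⟩
      countF (M v) + 𝟙 ⌊ u Fin.≟ v ⌋ + 𝟙 ⌊ w Fin.≟ v ⌋
    ∎
    where open ≤-Reasoning

  addEdge-degree≤ : ∀ {Δ} (M : Adj n) {u w} → u ≢ w → countF (M u) < Δ → countF (M w) < Δ →
    (∀ v → countF (M v) ≤ Δ) → ∀ v → countF (addEdge M u w v) ≤ Δ
  addEdge-degree≤ M {u} {w} u≢w u<Δ w<Δ M≤Δ v = ≤-trans (addEdge-degree M u w v) (bound v)
    where
    bound : ∀ v → countF (M v) + 𝟙 ⌊ u Fin.≟ v ⌋ + 𝟙 ⌊ w Fin.≟ v ⌋ ≤ _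
    bound v with u Fin.≟ v | w Fin.≟ v
    ... | yes refl | yes w≡u = contradiction (sym w≡u) u≢w
    ... | yes refl | no  _   = ≤-trans (≤-reflexive (trans (+-identityʳ _) (+-comm (countF (M u)) 1))) u<Δ
    ... | no  _    | yes refl =
      ≤-trans (≤-reflexive (trans (cong (_+ 1) (+-identityʳ _)) (+-comm (countF (M w)) 1))) w<Δ
    ... | no  _    | no  _   = ≤-trans (≤-reflexive (trans (+-identityʳ _) (+-identityʳ _))) (M≤Δ v)

  addEdge-off-edge : ∀ {M u w a b} → addEdge M u w a b ≡ true → edge u w a b ≡ false → M a b ≡ true
  addEdge-off-edge {M} {a = a} {b} e off =
    trans (sym (∨-identityʳ (M a b))) (subst (λ x → M a b ∨ x ≡ true) off e)

  ⊆-addEdge-without : ∀ {E M u w} → E ⊆ addEdge M u w → Symmetric E → E u w ≡ false → E ⊆ M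
  ⊆-addEdge-without {E} {M} {u} {w} E⊆ E-sym uw a b Eab with edge u w a b in e
  ... | false = addEdge-off-edge {M} {u} {w} (E⊆ a b Eab) e
  ... | true with edge≡true⇒ u w a b e
  ...   | inj₁ (refl , refl) = contradiction (trans (sym uw) Eab) (λ ())
  ...   | inj₂ (refl , refl) = contradiction (trans (sym uw) (trans (E-sym u w) Eab)) (λ ())

  removeEdge-sym : ∀ {E u w} → Symmetric E → Symmetric (removeEdge E u w)
  removeEdge-sym {u = u} {w} E-sym a b = cong₂ _∧_ (E-sym a b) (cong not (sym (edge-flip u w a b)))

  removeEdge-⊆ : ∀ {E} u w → removeEdge E u w ⊆ E
  removeEdge-⊆ u w a b = ∧-conicalˡ _ _

  removeEdge-⊆-addEdge : ∀ {E M u w} → E ⊆ addEdge M u w → removeEdge E u w ⊆ M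
  removeEdge-⊆-addEdge {M = M} {u} {w} E⊆ a b e =
    addEdge-off-edge {M} {u} {w} (E⊆ a b (∧-conicalˡ _ _ e)) (not≡true⇒≡false (∧-conicalʳ _ _ e))

  degreeSum-+ : ∀ (E F G : Adj n) → (∀ a b → 𝟙 (E a b) ≡ 𝟙 (F a b) + 𝟙 (G a b)) →
    degreeSum E ≡ degreeSum F + degreeSum G
  degreeSum-+ E F G split =
    trans (sumF-cong (λ a → trans (sumF-cong (split a)) (sumF-+ (𝟙 ∘ F a) (𝟙 ∘ G a))))
          (sumF-+ (countF ∘ F) (countF ∘ G))

  degreeSum-edge : ∀ {u w} → u ≢ w → degreeSum (edge u w) ≡ 2
  degreeSum-edge {u} {w} u≢w =
    trans (degreeSum-+ (edge u w) (arc u w) (arc w u) disjoint) (cong₂ _+_ (degreeSum-arc u w) (degreeSum-arc w u))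
    where
    disjoint : ∀ a b → 𝟙 (edge u w a b) ≡ 𝟙 (arc u w a b) + 𝟙 (arc w u a b)
    disjoint a b with arc u w a b in e₁ | arc w u a b in e₂
    ... | true  | true  =
      contradiction (trans (proj₁ (arc≡true⇒ u w a b e₁)) (sym (proj₁ (arc≡true⇒ w u a b e₂)))) u≢w
    ... | true  | false = refl
    ... | false | _     = refl

  degreeSum-removeEdge : ∀ {E u w} → Symmetric E → u ≢ w → E u w ≡ true →
    degreeSum E ≡ degreeSum (removeEdge E u w) + 2
  degreeSum-removeEdge {E} {u} {w} E-sym u≢w uw =
    trans (degreeSum-+ E (removeEdge E u w) (edge u w) split)
          (cong (degreeSum (removeEdge E u w) +_) (degreeSum-edge u≢w))
    where
    split : ∀ a b → 𝟙 (E a b) ≡ 𝟙 (removeEdge E u w a b) + 𝟙 (edge u w a b)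
    split a b with edge u w a b in e
    ... | false rewrite ∧-identityʳ (E a b) = sym (+-identityʳ _)
    ... | true with edge≡true⇒ u w a b e
    ...   | inj₁ (refl , refl) rewrite uw = refl
    ...   | inj₂ (refl , refl) rewrite E-sym w u | uw = refl

-- Sparse graphs

module _ {n : ℕ} where

  -- As degreeSum counts every edge twice, this says that every nonempty subgraph
  -- with at most C edges has more non-isolated vertices than edges.
  Sparse : ℕ → Adj n → Set
  Sparse C M = ∀ E → E ⊆ M → Symmetric E → 1 ≤ degreeSum E → degreeSum E ≤ 2 * C →
    degreeSum E + 2 ≤ 2 * support E

  sparse-empty : ∀ {C} → Sparse C (λ _ _ → false)
  sparse-empty E E⊆∅ _ E≢∅ _ =
    contradiction (≤-trans E≢∅ (≤-reflexive (sumF-zero (λ a → countF-false (E≡false a))))) λ ()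
    where
    E≡false : ∀ a b → E a b ≡ false
    E≡false a b with E a b in Eab
    ... | false = refl
    ... | true  = sym (E⊆∅ a b Eab)

  sparse-bound : ∀ {C M F s} → Sparse C M → F ⊆ M → Symmetric F → degreeSum F ≤ 2 * C →
    support F ≤ s → 1 ≤ s → degreeSum F + 2 ≤ 2 * s
  sparse-bound {F = F} sparse F⊆M F-sym F≤2C F≤s 1≤s with 1 ≤? degreeSum F
  ... | yes F≢∅ = ≤-trans (sparse F F⊆M F-sym F≢∅ F≤2C) (*-monoʳ-≤ 2 F≤s)
  ... | no  F≡∅ rewrite n<1⇒n≡0 (≰⇒> F≡∅) = *-monoʳ-≤ 2 1≤s

  sparse-density : ∀ {C M E} → Sparse C M → E ⊆ M → Symmetric E → degreeSum E ≤ 2 * C →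
    (C + 1) * degreeSum E ≤ 2 * C * support E
  sparse-density {C} {E = E} sparse E⊆M E-sym E≤2C with 1 ≤? degreeSum E
  ... | no  E≡∅ rewrite n<1⇒n≡0 (≰⇒> E≡∅) | *-zeroʳ (C + 1) = z≤n
  ... | yes E≢∅ = begin
      (C + 1) * d       ≡⟨ split C d ⟩
      C * d + d         ≤⟨ +-monoʳ-≤ (C * d) (≤-trans E≤2C (≤-reflexive (*-comm 2 C))) ⟩
      C * d + C * 2     ≡⟨ sym (*-distribˡ-+ C d 2) ⟩
      C * (d + 2)       ≤⟨ *-monoʳ-≤ C (sparse E E⊆M E-sym E≢∅ E≤2C) ⟩
      C * (2 * support E) ≡⟨ regroup C (support E) ⟩
      2 * C * support E ∎
    where
    open ≤-Reasoning
    d = degreeSum E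
    split : ∀ C d → (C + 1) * d ≡ C * d + d
    split = solve-∀
    regroup : ∀ C v → C * (2 * v) ≡ 2 * C * v
    regroup = solve-∀

countF-crossings≤1 : ∀ N (t s : ℕ → Bool) → (∀ k → s k ≡ true → s (suc k) ≡ true) →
  (∀ k → t k ≡ true → s (suc k) ≡ true) → countF {N} (λ j → t (toℕ j) ∧ not (s (toℕ j))) ≤ 1
countF-crossings≤1 zero    t s s-mono t⇒s = z≤n
countF-crossings≤1 (suc N) t s s-mono t⇒s with t 0 ∧ not (s 0) in first
... | true  = ≤-reflexive (cong suc (countF-false {N} (never-again ∘ toℕ)))
  where
  later : ∀ k → s (suc k) ≡ true
  later zero    = t⇒s 0 (∧-conicalˡ _ _ first)
  later (suc k) = s-mono (suc k) (later k)
  never-again : ∀ k → t (suc k) ∧ not (s (suc k)) ≡ false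
  never-again k rewrite later k = ∧-zeroʳ (t (suc k))
... | false = countF-crossings≤1 N (t ∘ suc) (s ∘ suc) (s-mono ∘ suc) (t⇒s ∘ suc)

module _ {n : ℕ} where

  crossing : Adj n → (Fin n → Bool) → Adj n
  crossing F X a b = F a b ∧ (X a ∧ not (X b))

  restrict : Adj n → (Fin n → Bool) → Adj n
  restrict F X a b = X a ∧ F a b

  crossing-free⇒stays-inside : ∀ {F X} → degreeSum (crossing F X) ≡ 0 →
    ∀ a b → F a b ≡ true → X a ≡ true → X b ≡ true
  crossing-free⇒stays-inside {F} {X} no-crossing a b Fab Xa with X b in Xb
  ... | true  = refl
  ... | false =
    trans (sym (countF≡0⇒false (crossing F X a) (sumF≡0⇒≡0 (countF ∘ crossing F X) no-crossing a) b))
                      (∧-intro Fab (∧-intro Xa (cong not Xb)))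

  crossing-free⇒closed : ∀ {F X} → Symmetric F → degreeSum (crossing F X) ≡ 0 →
    ∀ a b → F a b ≡ true → X a ≡ X b
  crossing-free⇒closed {F} {X} F-sym no-crossing a b Fab with X a in Xa | X b in Xb
  ... | true  | true  = refl
  ... | false | false = refl
  ... | true  | false = trans (sym (crossing-free⇒stays-inside {F} {X} no-crossing a b Fab Xa)) Xb
  ... | false | true  =
    trans (sym Xa) (crossing-free⇒stays-inside {F} {X} no-crossing b a (trans (F-sym b a) Fab) Xb)

  restrict-⊆ : ∀ {F} X → restrict F X ⊆ F
  restrict-⊆ X a b = ∧-conicalʳ _ _

  restrict-sym : ∀ {F X} → Symmetric F → (∀ a b → F a b ≡ true → X a ≡ X b) → Symmetric (restrict F X)
  restrict-sym {F} {X} F-sym closed a b rewrite F-sym b a with F a b in Fab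
  ... | false = trans (∧-zeroʳ (X a)) (sym (∧-zeroʳ (X b)))
  ... | true  = cong (_∧ true) (closed a b Fab)

  degreeSum-restrict : ∀ F X → degreeSum F ≡ degreeSum (restrict F X) + degreeSum (restrict F (not ∘ X))
  degreeSum-restrict F X = trans (sumF-cong (λ a → countF-split (λ _ → X a) (F a)))
                                 (sumF-+ (countF ∘ restrict F X) (countF ∘ restrict F (not ∘ X)))

  support-restrict≤ : ∀ {F E} X → F ⊆ E → support (restrict F X) ≤ countF (λ v → X v ∧ anyF (E v))
  support-restrict≤ {F} {E} X F⊆E = countF-mono inside
    where
    inside : ∀ v → anyF (restrict F X v) ≡ true → X v ∧ anyF (E v) ≡ true
    inside v e with anyF-sound (restrict F X v) e
    ... | b , XvFvb =
      ∧-intro (∧-conicalˡ _ _ XvFvb) (anyF-intro (E v) b (F⊆E v b (∧-conicalʳ _ _ XvFvb)))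

  sparse-restrict-bound : ∀ {C M E F Y} → Sparse C M → F ⊆ M → F ⊆ E → Symmetric F → degreeSum E ≤ 2 * C →
    (∀ a b → F a b ≡ true → Y a ≡ Y b) → ∀ z → Y z ≡ true → anyF (E z) ≡ true →
    degreeSum (restrict F Y) + 2 ≤ 2 * countF (λ v → Y v ∧ anyF (E v))
  sparse-restrict-bound {C} {M} {E} {F} {Y} sparse F⊆M F⊆E F-sym E≤2C closed z Yz Ez =
    sparse-bound {C = C} {M = M} sparse (⊆-trans (restrict-⊆ {F = F} Y) F⊆M)
                 (restrict-sym {F = F} {Y} F-sym closed)
                 (≤-trans (degreeSum-mono (⊆-trans (restrict-⊆ {F = F} Y) F⊆E)) E≤2C)
                 (support-restrict≤ {F = F} {E = E} Y F⊆E) (countF-pos _ z (∧-intro Yz Ez))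

module _ {n : ℕ} (M : Adj n) (u : Fin n) where

  -- An edge a b leaves the ball of radius j for at most one j.
  crossings-total : ∀ {N F} → F ⊆ M →
    sumF {N} (λ j → degreeSum (crossing F (ball M (toℕ j) u))) ≤ degreeSum F
  crossings-total {N} {F} F⊆M = begin
      sumF (λ j → sumF (λ a → sumF (λ b → g j a b)))
    ≡⟨ sumF-swap (λ j a → sumF (λ b → g j a b)) ⟩
      sumF (λ a → sumF (λ j → sumF (λ b → g j a b)))
    ≡⟨ sumF-cong (λ a → sumF-swap (λ j b → g j a b)) ⟩
      sumF (λ a → sumF (λ b → sumF (λ j → g j a b)))
    ≤⟨ sumF-mono-≤ (λ a → sumF-mono-≤ (at-most-once a)) ⟩
      degreeSum F
    ∎
    where
    open ≤-Reasoning
    g : Fin N → Fin n → Fin n → ℕ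
    g j a b = 𝟙 (crossing F (ball M (toℕ j) u) a b)
    at-most-once : ∀ a b →
      countF {N} (λ j → F a b ∧ (ball M (toℕ j) u a ∧ not (ball M (toℕ j) u b))) ≤ 𝟙 (F a b)
    at-most-once a b with F a b in Fab
    ... | false = ≤-reflexive (countF-false {N} (λ _ → refl))
    ... | true  = countF-crossings≤1 N (λ k → ball M k u a) (λ k → ball M k u b) (λ k → ball-suc M k u b)
                                 (λ k ua → ball-step M k u a b ua (F⊆M a b Fab))

  no-crossing-level : ∀ {N F} → F ⊆ M → Symmetric F → degreeSum F < N →
    ∃ λ (j : Fin N) → ∀ a b → F a b ≡ true → ball M (toℕ j) u a ≡ ball M (toℕ j) u b
  no-crossing-level {N} {F} F⊆M F-sym F<N
    with sumF<n⇒∃≡0 _ (≤-<-trans (crossings-total {N} {F} F⊆M) F<N)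
  ... | j , no-crossing = j , crossing-free⇒closed F-sym no-crossing

-- Removing the new edge u w from a small subgraph, some ball around u of radius
-- below 2C is cut by no remaining edge; u lies inside it and w outside, so the
-- subgraph splits into two parts to which sparsity of M applies separately.
sparse-addEdge-through : ∀ {n C} {M E : Adj n} {u w} → Sparse C M → ball M (2 * C) u w ≡ false →
  E ⊆ addEdge M u w → Symmetric E → degreeSum E ≤ 2 * C → E u w ≡ true → degreeSum E + 2 ≤ 2 * support E
sparse-addEdge-through {n} {C} {M} {E} {u} {w} sparse far E⊆ E-sym E≤2C uw = begin
    degreeSum E + 2
  ≡⟨ cong (_+ 2) (trans E≡E′+2 (cong (_+ 2) (degreeSum-restrict E′ X))) ⟩
    degreeSum In + degreeSum Out + 2 + 2
  ≡⟨ trans (+-assoc _ 2 2) (interchange (degreeSum In) (degreeSum Out) 2 2) ⟩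
    (degreeSum In + 2) + (degreeSum Out + 2)
  ≤⟨ +-mono-≤ (part-bound X X-closed u (ball-centre M (toℕ j) u) (anyF-intro (E u) w uw))
              (part-bound (not ∘ X) (λ a b e → cong not (X-closed a b e)) w (cong not Xw)
                          (anyF-intro (E w) u (trans (E-sym w u) uw))) ⟩
    2 * countF (λ v → X v ∧ anyF (E v)) + 2 * countF (λ v → not (X v) ∧ anyF (E v))
  ≡⟨ sym (*-distribˡ-+ 2 (countF (λ v → X v ∧ anyF (E v))) (countF (λ v → not (X v) ∧ anyF (E v)))) ⟩
    2 * (countF (λ v → X v ∧ anyF (E v)) + countF (λ v → not (X v) ∧ anyF (E v)))
  ≡⟨ cong (2 *_) (sym (countF-split X (λ v → anyF (E v)))) ⟩
    2 * support E
  ∎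
  where
  open ≤-Reasoning
  E′ : Adj n
  E′ = removeEdge E u w
  E′⊆M : E′ ⊆ M
  E′⊆M = removeEdge-⊆-addEdge {E = E} {M} {u} {w} E⊆
  E′-sym : Symmetric E′
  E′-sym = removeEdge-sym {E = E} {u} {w} E-sym
  E≡E′+2 : degreeSum E ≡ degreeSum E′ + 2
  E≡E′+2 = degreeSum-removeEdge {E = E} {u} {w} E-sym (far⇒≢ M {2 * C} {u} {w} far) uw
  E′<2C : degreeSum E′ < 2 * C
  E′<2C = ≤-trans (≤-trans (n≤1+n _) (≤-reflexive (+-comm 2 (degreeSum E′))))
                  (≤-trans (≤-reflexive (sym E≡E′+2)) E≤2C)
  level = no-crossing-level M u E′⊆M E′-sym E′<2C
  j : Fin (2 * C)
  j = proj₁ level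
  X : Fin n → Bool
  X = ball M (toℕ j) u
  X-closed : ∀ a b → E′ a b ≡ true → X a ≡ X b
  X-closed = proj₂ level
  Xw : X w ≡ false
  Xw with X w in uw-near
  ... | false = refl
  ... | true  = trans (sym (ball-mono-≤ M u w (<⇒≤ (toℕ<n j)) uw-near)) far
  In Out : Adj n
  In  = restrict E′ X
  Out = restrict E′ (not ∘ X)
  part-bound : ∀ Y → (∀ a b → E′ a b ≡ true → Y a ≡ Y b) → ∀ z → Y z ≡ true → anyF (E z) ≡ true →
    degreeSum (restrict E′ Y) + 2 ≤ 2 * countF (λ v → Y v ∧ anyF (E v))
  part-bound Y =
    sparse-restrict-bound {C = C} {M} {E} {E′} {Y} sparse E′⊆M (removeEdge-⊆ {E = E} u w) E′-sym E≤2C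

sparse-addEdge : ∀ {n C} {M : Adj n} {u w} → Sparse C M → ball M (2 * C) u w ≡ false → Sparse C (addEdge M u w)
sparse-addEdge {C = C} {M = M} {u} {w} sparse far E E⊆ E-sym E≢∅ E≤2C with E u w in uw
... | false = sparse E (⊆-addEdge-without E⊆ E-sym uw) E-sym E≢∅ E≤2C
... | true  = sparse-addEdge-through {C = C} {M = M} {E} {u} {w} sparse far E⊆ E-sym E≤2C uw

-- The greedy graph

module Greedy {n : ℕ} (C Δ : ℕ) (1≤C : 1 ≤ C) (S : Fin n → Bool) where

  deficient : Adj n → Fin n → Bool
  deficient M v = S v ∧ (countF (M v) <ᵇ Δ)

  admissible : Adj n → Fin n → Fin n → Bool
  admissible M u w = deficient M u ∧ deficient M w

  addable : Adj n → Fin n → Fin n → Bool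
  addable M u w = admissible M u w ∧ not (ball M (2 * C) u w)

  step : Adj n → Fin n × Fin n → Adj n
  step M (u , w) = if addable M u w then addEdge M u w else M

  record Invariant (M : Adj n) : Set where
    field
      symmetric   : Symmetric M
      irreflexive : Irreflexive M
      degree≤Δ    : ∀ v → countF (M v) ≤ Δ
      within-S    : ∀ a b → M a b ≡ true → S a ≡ true
      sparse      : Sparse C M

  open Invariant

  empty-invariant : Invariant (λ _ _ → false)
  empty-invariant = record
    { symmetric   = λ _ _ → refl
    ; irreflexive = λ _ → refl
    ; degree≤Δ    = λ _ → subst (_≤ Δ) (sym (countF-false {n} (λ _ → refl))) z≤n
    ; within-S    = λ _ _ ()
    ; sparse      = sparse-empty {C = C}
    }

  addEdge-invariant : ∀ {M u w} → Invariant M → addable M u w ≡ true → Invariant (addEdge M u w)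
  addEdge-invariant {M} {u} {w} I ok = record
    { symmetric   = addEdge-sym {M = M} {u} {w} (symmetric I)
    ; irreflexive = addEdge-irrefl {M = M} (irreflexive I) u≢w
    ; degree≤Δ    = addEdge-degree≤ M u≢w (deficient⇒< u-deficient) (deficient⇒< w-deficient) (degree≤Δ I)
    ; within-S    = addEdge-sources {M = M} S (within-S I) (∧-conicalˡ _ _ u-deficient) (∧-conicalˡ _ _ w-deficient)
    ; sparse      = sparse-addEdge {C = C} {M = M} {u} {w} (sparse I) far
    }
    where
    adm : admissible M u w ≡ true
    adm = ∧-conicalˡ _ _ ok
    u-deficient : deficient M u ≡ true
    u-deficient = ∧-conicalˡ _ (deficient M w) adm
    w-deficient : deficient M w ≡ true
    w-deficient = ∧-conicalʳ (deficient M u) _ adm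
    far : ball M (2 * C) u w ≡ false
    far = not≡true⇒≡false (∧-conicalʳ _ _ ok)
    u≢w : u ≢ w
    u≢w = far⇒≢ M {2 * C} far
    deficient⇒< : ∀ {v} → deficient M v ≡ true → countF (M v) < Δ
    deficient⇒< = <ᵇ≡true⇒< ∘ ∧-conicalʳ _ _

  step-invariant : ∀ {M} → Invariant M → ∀ p → Invariant (step M p)
  step-invariant {M} I (u , w) with addable M u w in ok
  ... | true  = addEdge-invariant I ok
  ... | false = I

  step-⊇ : ∀ M p → M ⊆ step M p
  step-⊇ M (u , w) a b Mab with addable M u w
  ... | true  = ⊆-addEdge {M = M} u w a b Mab
  ... | false = Mab

  deficient-antimono : ∀ {M M′} → M ⊆ M′ → ∀ v → deficient M′ v ≡ true → deficient M v ≡ true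
  deficient-antimono {M} {M′} M⊆M′ v e =
    ∧-intro (∧-conicalˡ (S v) _ e)
            (<⇒<ᵇ≡true {countF (M v)} {Δ}
              (≤-<-trans (countF-mono (M⊆M′ v)) (<ᵇ≡true⇒< (∧-conicalʳ (S v) _ e))))

  Saturated : Adj n → Fin n × Fin n → Set
  Saturated M (u , w) = admissible M u w ≡ true → ball M (2 * C) u w ≡ true

  saturated-mono : ∀ {M M′} → M ⊆ M′ → ∀ p → Saturated M p → Saturated M′ p
  saturated-mono {M} {M′} M⊆M′ (u , w) sat adm =
    ball-mono-⊆ M⊆M′ (2 * C) u w (sat (∧-intro (deficient-antimono M⊆M′ u (∧-conicalˡ _ (deficient M′ w) adm))
                                                (deficient-antimono M⊆M′ w (∧-conicalʳ (deficient M′ u) _ adm))))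

  step-saturates : ∀ M p → Saturated (step M p) p
  step-saturates M (u , w) adm with addable M u w in ok
  ... | true  = ball-mono-≤ (addEdge M u w) u w (≤-trans 1≤C (m≤m+n C _))
                              (ball-step (addEdge M u w) 0 u u w (≟-refl u) (addEdge-new M u w))
  ... | false rewrite adm = not-injective {y = true} ok

  run-invariant : ∀ {M} → Invariant M → ∀ ps → Invariant (foldl step M ps)
  run-invariant I []       = I
  run-invariant I (p ∷ ps) = run-invariant (step-invariant I p) ps

  run-⊇ : ∀ M ps → M ⊆ foldl step M ps
  run-⊇ M []       = λ _ _ → id
  run-⊇ M (p ∷ ps) = ⊆-trans (step-⊇ M p) (run-⊇ (step M p) ps)

  run-saturated : ∀ M ps p → p ∈ ps → Saturated (foldl step M ps) p
  run-saturated M (p ∷ ps) p (here refl) = saturated-mono (run-⊇ (step M p) ps) p (step-saturates M p)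
  run-saturated M (q ∷ ps) p (there p∈ps) = run-saturated (step M q) ps p p∈ps

  allPairs : List (Fin n × Fin n)
  allPairs = cartesianProduct (allFin n) (allFin n)

  greedy : Adj n
  greedy = foldl step (λ _ _ → false) allPairs

  greedy-invariant : Invariant greedy
  greedy-invariant = run-invariant empty-invariant allPairs

  greedy-saturated : ∀ u w → admissible greedy u w ≡ true → ball greedy (2 * C) u w ≡ true
  greedy-saturated u w = run-saturated _ allPairs (u , w) (∈-cartesianProduct⁺ (∈-allFin u) (∈-allFin w))

-- The counting argument

ceilDiv-spec : ∀ a b → ceilDiv a (suc b) * suc b ≤ a + b
ceilDiv-spec a b = m/n*n≤m (a + b) (suc b)

*-cancelʳ-≤-slack : ∀ x m e → x * suc e ≤ m * suc e + e → x ≤ m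
*-cancelʳ-≤-slack x m e x·n≤m·n+e with x ≤? m
... | yes x≤m = x≤m
... | no  x≰m = contradiction x·n≤m·n+e (<⇒≱ (begin-strict
    m * suc e + e        <⟨ +-monoʳ-< (m * suc e) (n<1+n e) ⟩
    m * suc e + suc e    ≡⟨ +-comm (m * suc e) (suc e) ⟩
    suc m * suc e        ≤⟨ *-monoˡ-≤ (suc e) (≰⇒> x≰m) ⟩
    x * suc e            ∎))
  where open ≤-Reasoning

-- Used with k = C + 1, suc b = 2C, D the degree sum, P the number of appearances,
-- s the number of low-budget nodes and B the bound on deficient nodes.
budget-arithmetic : ∀ k Δ B {b K D P s} → k * D ≤ suc b * P → P + s ≤ K * s → Δ * s ≤ D + Δ * B →
  K * suc b ≤ k * Δ + b → s ≤ k * Δ * B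
budget-arithmetic k Δ B {b} {K} {D} {P} {s} colours budgets degrees ceiling =
  +-cancelʳ-≤ (a * s + b * s) s (a * B) (begin
    s + (a * s + b * s)             ≡⟨ regroup₁ a b s ⟩
    a * s + suc b * s               ≤⟨ +-monoˡ-≤ (suc b * s) edges ⟩
    suc b * P + a * B + suc b * s   ≡⟨ regroup₂ a b P s B ⟩
    a * B + suc b * (P + s)         ≤⟨ +-monoʳ-≤ (a * B) occurrences ⟩
    a * B + (a + b) * s             ≡⟨ cong (a * B +_) (*-distribʳ-+ s a b) ⟩
    a * B + (a * s + b * s)         ∎)
  where
  open ≤-Reasoning
  a = k * Δ
  edges : a * s ≤ suc b * P + a * B
  edges = begin
    a * s              ≡⟨ *-assoc k Δ s ⟩
    k * (Δ * s)        ≤⟨ *-monoʳ-≤ k degrees ⟩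
    k * (D + Δ * B)    ≡⟨ trans (*-distribˡ-+ k D (Δ * B)) (cong (k * D +_) (sym (*-assoc k Δ B))) ⟩
    k * D + a * B      ≤⟨ +-monoˡ-≤ (a * B) colours ⟩
    suc b * P + a * B  ∎
  occurrences : suc b * (P + s) ≤ (a + b) * s
  occurrences = begin
    suc b * (P + s)    ≤⟨ *-monoʳ-≤ (suc b) budgets ⟩
    suc b * (K * s)    ≡⟨ trans (sym (*-assoc (suc b) K s)) (cong (_* s) (*-comm (suc b) K)) ⟩
    K * suc b * s      ≤⟨ *-monoˡ-≤ s ceiling ⟩
    (a + b) * s        ∎
  regroup₁ : ∀ a b s → s + (a * s + b * s) ≡ a * s + suc b * s
  regroup₁ = solve-∀
  regroup₂ : ∀ a b P s B → suc b * P + a * B + suc b * s ≡ a * B + suc b * (P + s)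
  regroup₂ = solve-∀

module LowBudget {n : ℕ} (c Δ K : ℕ) (A : Fin n → ℕ) where

  C : ℕ
  C = suc c

  lowBudget : Fin n → Bool
  lowBudget v = A v <ᵇ K

  open Greedy C Δ (s≤s z≤n) lowBudget
  open Invariant greedy-invariant

  R : Graph n
  R = record { adj = greedy ; sym = symmetric ; irrefl = irreflexive }

  ballBound : ℕ
  ballBound = suc Δ ^ (2 * C)

  -- By saturation all deficient vertices lie in the ball of radius 2C around any one of them.
  deficient-count≤ : countF (deficient greedy) ≤ ballBound
  deficient-count≤ with anyF (deficient greedy) in some
  ... | false = ≤-trans (≤-reflexive (countF-false (anyF≡false⇒ (deficient greedy) some))) z≤n
  ... | true with anyF-sound (deficient greedy) some
  ...   | u , u-deficient =
    ≤-trans (countF-mono (λ w w-deficient → greedy-saturated u w (∧-intro u-deficient w-deficient)))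
            (ball-size greedy Δ degree≤Δ (2 * C) u)

  lowBudget-degrees : Δ * countF lowBudget ≤ degreeSum greedy + Δ * ballBound
  lowBudget-degrees = begin
      Δ * countF lowBudget
    ≡⟨ sym (sumF-*ˡ Δ (𝟙 ∘ lowBudget)) ⟩
      sumF (λ v → Δ * 𝟙 (lowBudget v))
    ≤⟨ sumF-mono-≤ full-or-deficient ⟩
      sumF (λ v → countF (greedy v) + Δ * 𝟙 (deficient greedy v))
    ≡⟨ sumF-+ (countF ∘ greedy) _ ⟩
      degreeSum greedy + sumF (λ v → Δ * 𝟙 (deficient greedy v))
    ≡⟨ cong (degreeSum greedy +_) (sumF-*ˡ Δ (𝟙 ∘ deficient greedy)) ⟩
      degreeSum greedy + Δ * countF (deficient greedy)
    ≤⟨ +-monoʳ-≤ _ (*-monoʳ-≤ Δ deficient-count≤) ⟩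
      degreeSum greedy + Δ * ballBound
    ∎
    where
    open ≤-Reasoning
    full-or-deficient : ∀ v → Δ * 𝟙 (lowBudget v) ≤ countF (greedy v) + Δ * 𝟙 (deficient greedy v)
    full-or-deficient v with lowBudget v
    ... | false = ≤-trans (≤-reflexive (*-zeroʳ Δ)) z≤n
    ... | true with countF (greedy v) <ᵇ Δ in d
    ...   | true  = m≤n+m (Δ * 1) _
    ...   | false = ≤-trans (≤-reflexive (*-identityʳ Δ)) (≤-trans (<ᵇ≡false⇒≥ d) (m≤m+n _ _))

  colouring-degrees : ∀ {Λ} (col : Fin n → Fin n → Fin Λ) → (∀ i j → col i j ≡ col j i) →
    (∀ l → classSize R col l ≤ C) → (C + 1) * degreeSum greedy ≤ 2 * C * sumF (appearances R col)
  colouring-degrees col col-sym col-size = begin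
      (C + 1) * degreeSum greedy
    ≡⟨ cong ((C + 1) *_) (sym (degreeSum-colourClasses greedy col)) ⟩
      (C + 1) * sumF (λ l → degreeSum (class l))
    ≡⟨ sym (sumF-*ˡ (C + 1) (degreeSum ∘ class)) ⟩
      sumF (λ l → (C + 1) * degreeSum (class l))
    ≤⟨ sumF-mono-≤ class-density ⟩
      sumF (λ l → 2 * C * support (class l))
    ≡⟨ sumF-*ˡ (2 * C) (support ∘ class) ⟩
      2 * C * sumF (λ l → support (class l))
    ≡⟨ cong (2 * C *_) (sumF-swap (λ l v → 𝟙 (appearsIn R col v l))) ⟩
      2 * C * sumF (appearances R col)
    ∎
    where
    open ≤-Reasoning
    class = colourClass greedy col
    class-sym : ∀ l → Symmetric (class l)
    class-sym = colourClass-sym greedy col symmetric col-sym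
    class≤2C : ∀ l → degreeSum (class l) ≤ 2 * C
    class≤2C l = ≤-trans (≤-reflexive (handshake (class-sym l) (colourClass-irrefl greedy col irreflexive l)))
                         (*-monoʳ-≤ 2 (col-size l))
    class-density : ∀ l → (C + 1) * degreeSum (class l) ≤ 2 * C * support (class l)
    class-density l = sparse-density {C = C} {E = class l} sparse (colourClass-⊆ greedy col l) (class-sym l) (class≤2C l)

  highBudget-isolated : ∀ {Λ} (col : Fin n → Fin n → Fin Λ) v → lowBudget v ≡ false → appearances R col v ≡ 0
  highBudget-isolated col v high = countF-false (λ l → anyF-false (λ u → no-edge l u))
    where
    no-edge : ∀ l u → greedy v u ∧ ⌊ col v u Fin.≟ l ⌋ ≡ false
    no-edge l u with greedy v u in vu
    ... | false = refl
    ... | true  = contradiction (trans (sym high) (within-S v u vu)) λ ()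

  appearances-budget : ∀ {Λ} (col : Fin n → Fin n → Fin Λ) → (∀ v → appearances R col v ≤ A v) →
    sumF (appearances R col) + countF lowBudget ≤ K * countF lowBudget
  appearances-budget col col≤A = begin
      sumF (appearances R col) + countF lowBudget
    ≡⟨ sym (sumF-+ (appearances R col) (𝟙 ∘ lowBudget)) ⟩
      sumF (λ v → appearances R col v + 𝟙 (lowBudget v))
    ≤⟨ sumF-mono-≤ below-budget ⟩
      sumF (λ v → K * 𝟙 (lowBudget v))
    ≡⟨ sumF-*ˡ K (𝟙 ∘ lowBudget) ⟩
      K * countF lowBudget
    ∎
    where
    open ≤-Reasoning
    below-budget : ∀ v → appearances R col v + 𝟙 (lowBudget v) ≤ K * 𝟙 (lowBudget v)
    below-budget v with lowBudget v in low
    ... | true  = ≤-trans (≤-reflexive (+-comm _ 1))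
                          (≤-trans (≤-trans (s≤s (col≤A v)) (<ᵇ≡true⇒< low)) (≤-reflexive (sym (*-identityʳ K))))
    ... | false = ≤-reflexive (trans (+-identityʳ _) (trans (highBudget-isolated col v low) (sym (*-zeroʳ K))))

  budget-total : n * K ≤ sumF A + K * countF lowBudget
  budget-total = begin
      n * K
    ≡⟨ sym (sumF-const {n} K) ⟩
      sumF {n} (λ _ → K)
    ≤⟨ sumF-mono-≤ at-least-K ⟩
      sumF (λ v → A v + K * 𝟙 (lowBudget v))
    ≡⟨ trans (sumF-+ A (λ v → K * 𝟙 (lowBudget v))) (cong (sumF A +_) (sumF-*ˡ K (𝟙 ∘ lowBudget))) ⟩
      sumF A + K * countF lowBudget
    ∎
    where
    open ≤-Reasoning
    at-least-K : ∀ v → K ≤ A v + K * 𝟙 (lowBudget v)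
    at-least-K v with lowBudget v in low
    ... | true  = ≤-trans (≤-reflexive (sym (*-identityʳ K))) (m≤n+m _ (A v))
    ... | false = ≤-trans (<ᵇ≡false⇒≥ low) (m≤m+n (A v) _)

  feasible⇒budget≥ : Feasible n C Δ A → K * (2 * C) ≤ (C + 1) * Δ + (2 * C ∸ 1) →
    n * K ≤ sumF A + K * ((C + 1) * Δ * ballBound)
  feasible⇒budget≥ feasible ceiling with feasible R degree≤Δ
  ... | _ , col , col-sym , col-size , col≤A =
    ≤-trans budget-total (+-monoʳ-≤ (sumF A) (*-monoʳ-≤ K
      (budget-arithmetic (C + 1) Δ ballBound {K = K} (colouring-degrees col col-sym col-size)
                         (appearances-budget col col≤A) lowBudget-degrees ceiling)))

proposition1 : ∀ (C Δ : ℕ) → 1 ≤ C → 1 ≤ Δ →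
    ∀ (m d : ℕ) → 1 ≤ m → 1 ≤ d → BoundHolds C Δ m d →
    d * ceilDiv ((C + 1) * Δ) (2 * C) ≤ m
proposition1 (suc c) Δ _ _ m d _ _ bound = *-cancelʳ-≤-slack (d * K) m (d * K * h) (begin
    d * K * n₀
  ≡⟨ trans (*-assoc d K n₀) (cong (d *_) (*-comm K n₀)) ⟩
    d * (n₀ * K)
  ≤⟨ *-monoʳ-≤ d (feasible⇒budget≥ feasible (ceilDiv-spec ((suc c + 1) * Δ) (2 * suc c ∸ 1))) ⟩
    d * (sumF A + K * h)
  ≡⟨ trans (*-distribˡ-+ d (sumF A) (K * h)) (cong (d * sumF A +_) (sym (*-assoc d K h))) ⟩
    d * sumF A + d * K * h
  ≤⟨ +-monoˡ-≤ (d * K * h) total≤ ⟩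
    m * n₀ + d * K * h
  ∎)
  where
  open ≤-Reasoning
  K = ceilDiv ((suc c + 1) * Δ) (2 * suc c)
  h = (suc c + 1) * Δ * suc Δ ^ (2 * suc c)
  n₀ = suc (d * K * h)
  A = proj₁ (bound n₀ (s≤s z≤n))
  feasible = proj₁ (proj₂ (bound n₀ (s≤s z≤n)))
  total≤ = proj₂ (proj₂ (bound n₀ (s≤s z≤n)))
  open LowBudget c Δ K A using (feasible⇒budget≥)
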